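{- Suppose that $\theta=\{\langle x_1,M_1,\alpha_1\rangle,\dots,\langle x_n,M_n,\alpha_n\rangle\}$ is an arity type preserving substitution with respect to the arity context $\Theta$ and that $\mathrm{ctx}(\theta)\oplus\Theta\vdash t\Leftarrow\alpha$ is derivable. Then the term $(\lambda x_1.\cdots\lambda x_n.t)\,M_1\cdots M_n$ of the untyped $\lambda$-calculus is equal modulo $\lambda$-conversion to the term $t'$ such that $\theta(t)\rightsquigarrow t'$.
   Context: Canonical terms $M ::= R\mid\lambda x.M$, atomic terms $R ::= c\mid x\mid R\,M$ (with constants $c$ and variables $x$) form a subset of general $\lambda$-terms $T ::= c\mid x\mid\lambda x.T\mid T_1\,T_2$; equality of general terms is equality under the usual $\lambda$-conversion rules. Arity types $\alpha ::= o\mid\alpha\to\alpha$. A substitution $\theta$ is a finite set of triples $\langle x,M,\alpha\rangle$ with distinct variables; $\mathrm{ctx}(\theta)=\{x{:}\alpha\mid\langle x,M,\alpha\rangle\in\theta\}$. Hereditary substitution: $\theta(R)\rightsquigarrow R'$ if $\theta(R)\rightsquigarrow_r R'$; $\theta(R)\rightsquigarrow M'$ if $\theta(R)\rightsquigarrow_r M':\alpha'$; $\theta(\lambda x.M)\rightsquigarrow\lambda x.M'$ if $x$ is not in the domain of $\theta$ nor free in its range and $\theta(M)\rightsquigarrow M'$; $\theta(x)\rightsquigarrow_r M:\alpha$ if $\langle x,M,\alpha\rangle\in\theta$; $\theta(R\,M)\rightsquigarrow_r M''':\alpha''$ if $\theta(R)\rightsquigarrow_r\lambda x.M':\alpha'\to\alpha''$,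 $\theta(M)\rightsquigarrow M''$ and $\{\langle x,M'',\alpha'\rangle\}(M')\rightsquigarrow M'''$; $\theta(c)\rightsquigarrow_r c$; $\theta(x)\rightsquigarrow_r x$ if $x$ not in the domain of $\theta$; $\theta(R\,M)\rightsquigarrow_r R'\,M'$ if $\theta(R)\rightsquigarrow_r R'$ and $\theta(M)\rightsquigarrow M'$. Arity contexts: sets of unique arity type assignments to variables and constants, $\Theta_1\oplus\Theta_2$ being $\Theta_1$ plus assignments of $\Theta_2$ to symbols unassigned in $\Theta_1$. Arity typing: $\Theta\vdash h\Rightarrow\alpha$ if $h{:}\alpha\in\Theta$; $\Theta\vdash R\,M\Rightarrow\alpha$ if $\Theta\vdash R\Rightarrow\alpha'\to\alpha$ and $\Theta\vdash M\Leftarrow\alpha'$; $\Theta\vdash\lambda x.M\Leftarrow\alpha_1\to\alpha_2$ if $\{x{:}\alpha_1\}\oplus\Theta\vdash M\Leftarrow\alpha_2$; $\Theta\vdash R\Leftarrow o$ if $\Theta\vdash R\Rightarrow o$. $\theta$ is arity type preserving w.r.t. $\Theta$ if $\Theta\vdash M\Leftarrow\alpha$ for every $\langle x,M,\alpha\rangle\in\theta$ (this ensures $\theta(t)\rightsquigarrow t'$ exists and is unique). -}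

module Defs where

open import Data.Nat using (ℕ)
open import Data.Nat.Properties using (_≟_)
open import Data.Bool using (Bool; true; false; if_then_else_)
open import Data.Product using (_×_; _,_; proj₁)
open import Data.List using (List; []; _∷_; _++_; map; filter; foldr; foldl)
open import Data.List.Membership.Propositional using (_∈_; _∉_)
open import Data.List.Relation.Unary.All using (All)
open import Data.List.Relation.Unary.Unique.Propositional using (Unique)
open import Relation.Nullary using (¬_; Dec; yes; no)
open import Relation.Nullary.Decidable using (does)
open import Relation.Binary.PropositionalEquality using (_≡_; refl; cong)
import Data.List.Membership.DecPropositional as DecMem
import Data.List.Membership.DecPropositional

Var : Set
Var = ℕ

Const : Set
Const = ℕ

data Tm : Set where
  con : Const → Tm
  `_  : Var → Tm
  ƛ_⇒_ : Var → Tm → Tm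
  _·_ : Tm → Tm → Tm

infixl 7 _·_

FV : Tm → List Var
FV (con c) = []
FV (` x) = x ∷ []
FV (ƛ x ⇒ T) = filter (λ y → Relation.Nullary.¬? (y ≟ x)) (FV T)
FV (T · U) = FV T ++ FV U

-- naive substitution T[U/x] (stops at a binder for x; capture is
-- excluded separately by the FreeFor side condition)
_[_/_] : Tm → Tm → Var → Tm
con c [ U / x ] = con c
(` y) [ U / x ] = if does (y ≟ x) then U else ` y
(ƛ y ⇒ T) [ U / x ] = if does (y ≟ x) then ƛ y ⇒ T else ƛ y ⇒ (T [ U / x ])
(T · T') [ U / x ] = (T [ U / x ]) · (T' [ U / x ])

data FreeFor (U : Tm) (x : Var) : Tm → Set where
  ff-con : ∀ {c} → FreeFor U x (con c)
  ff-var : ∀ {y} → FreeFor U x (` y)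
  ff-app : ∀ {T T'} → FreeFor U x T → FreeFor U x T' → FreeFor U x (T · T')
  ff-lam-same : ∀ {T} → FreeFor U x (ƛ x ⇒ T)
  ff-lam-nofree : ∀ {y T} → x ∉ FV (ƛ y ⇒ T) → FreeFor U x (ƛ y ⇒ T)
  ff-lam : ∀ {y T} → ¬ (y ≡ x) → y ∉ FV U → FreeFor U x T → FreeFor U x (ƛ y ⇒ T)

data _≡λ_ : Tm → Tm → Set where
  λ-refl  : ∀ {T} → T ≡λ T
  λ-sym   : ∀ {T U} → T ≡λ U → U ≡λ T
  λ-trans : ∀ {T U V} → T ≡λ U → U ≡λ V → T ≡λ V
  λ-app   : ∀ {T T' U U'} → T ≡λ T' → U ≡λ U' → (T · U) ≡λ (T' · U')
  λ-lam   : ∀ {x T T'} → T ≡λ T' → (ƛ x ⇒ T) ≡λ (ƛ x ⇒ T')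
  λ-α     : ∀ {x y T} → y ∉ FV T → FreeFor (` y) x T →
            (ƛ x ⇒ T) ≡λ (ƛ y ⇒ (T [ ` y / x ]))
  λ-β     : ∀ {x T U} → FreeFor U x T → ((ƛ x ⇒ T) · U) ≡λ (T [ U / x ])
  λ-η     : ∀ {x T} → x ∉ FV T → (ƛ x ⇒ (T · ` x)) ≡λ T

infix 4 _≡λ_

mutual
  data Can : Set where
    atm : Atm → Can
    lam : Var → Can → Can

  data Atm : Set where
    cst : Const → Atm
    var : Var → Atm
    app : Atm → Can → Atm

mutual
  ⌜_⌝ : Can → Tm
  ⌜ atm R ⌝ = ⌜ R ⌝ᵣ
  ⌜ lam x M ⌝ = ƛ x ⇒ ⌜ M ⌝

  ⌜_⌝ᵣ : Atm → Tm
  ⌜ cst c ⌝ᵣ = con c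
  ⌜ var x ⌝ᵣ = ` x
  ⌜ app R M ⌝ᵣ = ⌜ R ⌝ᵣ · ⌜ M ⌝

FVc : Can → List Var
FVc M = FV ⌜ M ⌝

data Arity : Set where
  o : Arity
  _⇒_ : Arity → Arity → Arity

infixr 5 _⇒_

Subst : Set
Subst = List (Var × Can × Arity)

dom : Subst → List Var
dom θ = map proj₁ θ

FVrange : Subst → List Var
FVrange [] = []
FVrange ((x , M , α) ∷ θ) = FVc M ++ FVrange θ

DistinctVars : Subst → Set
DistinctVars θ = Unique (dom θ)

-- Hereditary substitution (as relations)
--   HS θ M M'        :  θ(M) ⇝ M'
--   HSra θ R R'      :  θ(R) ⇝ᵣ R'
--   HSrc θ R M α     :  θ(R) ⇝ᵣ M : α

mutual
  data HS (θ : Subst) : Can → Can → Set where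
    hs-atm-a : ∀ {R R'} → HSra θ R R' → HS θ (atm R) (atm R')
    hs-atm-c : ∀ {R M' α'} → HSrc θ R M' α' → HS θ (atm R) M'
    hs-lam   : ∀ {x M M'} → x ∉ dom θ → x ∉ FVrange θ → HS θ M M' →
               HS θ (lam x M) (lam x M')

  data HSrc (θ : Subst) : Atm → Can → Arity → Set where
    hsc-var : ∀ {x M α} → (x , M , α) ∈ θ → HSrc θ (var x) M α
    hsc-app : ∀ {R M x M' α' α'' M'' M'''} →
              HSrc θ R (lam x M') (α' ⇒ α'') → HS θ M M'' →
              HS ((x , M'' , α') ∷ []) M' M''' →
              HSrc θ (app R M) M''' α''

  data HSra (θ : Subst) : Atm → Atm → Set where
    hsa-cst : ∀ {c} → HSra θ (cst c) (cst c)
    hsa-var : ∀ {x} → x ∉ dom θ → HSra θ (var x) (var x)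
    hsa-app : ∀ {R R' M M'} → HSra θ R R' → HS θ M M' →
              HSra θ (app R M) (app R' M')

data Sym : Set where
  sc : Const → Sym
  sv : Var → Sym

_≟s_ : (a b : Sym) → Dec (a ≡ b)
sc a ≟s sc b with a ≟ b
... | yes refl = yes refl
... | no ne = no λ { refl → ne refl }
sc a ≟s sv b = no λ ()
sv a ≟s sc b = no λ ()
sv a ≟s sv b with a ≟ b
... | yes refl = yes refl
... | no ne = no λ { refl → ne refl }

ACtx : Set
ACtx = List (Sym × Arity)

symbols : ACtx → List Sym
symbols Θ = map proj₁ Θ

WellFormedCtx : ACtx → Set
WellFormedCtx Θ = Unique (symbols Θ)

assigned? : (Θ : ACtx) → (s : Sym) → Dec (s ∈ symbols Θ)
assigned? Θ s = DecMem._∈?_ _≟s_ s (symbols Θ)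

_⊕_ : ACtx → ACtx → ACtx
Θ₁ ⊕ Θ₂ = Θ₁ ++ filter (λ p → Relation.Nullary.¬? (assigned? Θ₁ (proj₁ p))) Θ₂

infixr 5 _⊕_

ctx : Subst → ACtx
ctx θ = map (λ { (x , M , α) → (sv x , α) }) θ

mutual
  data _⊢_⇒_ (Θ : ACtx) : Atm → Arity → Set where
    syn-cst : ∀ {c α} → (sc c , α) ∈ Θ → Θ ⊢ cst c ⇒ α
    syn-var : ∀ {x α} → (sv x , α) ∈ Θ → Θ ⊢ var x ⇒ α
    syn-app : ∀ {R M α α'} → Θ ⊢ R ⇒ (α' ⇒ α) → Θ ⊢ M ⇐ α' → Θ ⊢ app R M ⇒ α

  data _⊢_⇐_ (Θ : ACtx) : Can → Arity → Set where
    chk-lam : ∀ {x M α₁ α₂} → ((sv x , α₁) ∷ []) ⊕ Θ ⊢ M ⇐ α₂ →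
              Θ ⊢ lam x M ⇐ (α₁ ⇒ α₂)
    chk-atm : ∀ {R} → Θ ⊢ R ⇒ o → Θ ⊢ atm R ⇐ o

infix 3 _⊢_⇒_ _⊢_⇐_

ArityPreserving : Subst → ACtx → Set
ArityPreserving θ Θ = All (λ { (x , M , α) → Θ ⊢ M ⇐ α }) θ

lams : List Var → Tm → Tm
lams xs T = foldr ƛ_⇒_ T xs

apps : Tm → List Tm → Tm
apps T Us = foldl _·_ T Us

redex : Subst → Can → Tm
redex θ t = apps (lams (dom θ) ⌜ t ⌝) (map (λ { (x , M , α) → ⌜ M ⌝ }) θ)

module Submission where

-- Write ⟦T⟧ρ for (λx₁.⋯λxₙ.T) N₁ ⋯ Nₙ, where ρ pairs each xᵢ with Nᵢ. By induction on the
-- hereditary substitution derivation it suffices that, up to λ-conversion, ⟦T⟧ρ is T when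
-- no xᵢ occurs free in T, commutes with application and with abstraction over a variable
-- that is neither an xᵢ nor free in an Nᵢ, and sends xᵢ to Nᵢ; the case where hereditary
-- substitution creates a redex is then one more instance of the theorem, for a singleton
-- substitution. These four laws are first proved when no Nᵢ mentions a later xⱼ, by pushing
-- the outermost β-redex inwards one binder at a time. An arbitrary ρ is reduced to that
-- case by η: with fresh variables k, k+1, …, ⟦T⟧ρ ≡ (λk.λk+1.⋯ (λx⃗.T) k (k+1) ⋯) N⃗,
-- a composite of two environments of the restricted kind.

open import Defs
open import Data.Nat using (ℕ; suc; _<_; _≤_; s≤s)
open import Data.Nat.Properties using (_≟_; ≤-refl; <⇒≤; <⇒≱; <-irrefl; m<n⇒m<1+n; n<1+n)
open import Data.Product using (Σ-syntax; _×_; _,_; proj₁; proj₂)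
open import Data.Sum using (inj₁; inj₂)
open import Data.Empty using (⊥-elim)
open import Data.List using (List; []; _∷_; _++_; map)
open import Data.List.Properties using (map-∘)
open import Data.List.Extrema.Nat using (max; xs≤max)
open import Data.List.Membership.Propositional using (_∈_; _∉_)
open import Data.List.Membership.Propositional.Properties using (∈-filter⁻; ∈-filter⁺; ∈-++⁺ˡ; ∈-++⁺ʳ; ∈-++⁻; ∈-map⁺)
open import Data.List.Relation.Unary.Any using (here; there)
open import Data.List.Relation.Unary.All using ([]; lookup)
open import Data.List.Relation.Unary.All.Properties using (All¬⇒¬Any)
open import Data.List.Relation.Unary.AllPairs using ([]; _∷_)
open import Data.List.Relation.Unary.Unique.Propositional using (Unique)
open import Function using (_∘_)
open import Relation.Binary.Bundles using (Setoid)
open import Relation.Nullary using (¬_; yes; no; ¬?)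
open import Relation.Nullary.Decidable using (dec-true; dec-false)
open import Relation.Binary.PropositionalEquality using (_≡_; refl; sym; trans; cong; cong₂; subst)

≡λ-setoid : Setoid _ _
≡λ-setoid = record
  { Carrier = Tm
  ; _≈_ = _≡λ_
  ; isEquivalence = record { refl = λ-refl ; sym = λ-sym ; trans = λ-trans }
  }

open import Relation.Binary.Reasoning.Setoid ≡λ-setoid

≡⇒≡λ : ∀ {T U} → T ≡ U → T ≡λ U
≡⇒≡λ refl = λ-refl

[/]-var-≡ : ∀ x N → (` x) [ N / x ] ≡ N
[/]-var-≡ x N rewrite dec-true (x ≟ x) refl = refl

[/]-var-≢ : ∀ {x y} N → ¬ y ≡ x → (` y) [ N / x ] ≡ ` y
[/]-var-≢ {x} {y} N y≢x rewrite dec-false (y ≟ x) y≢x = refl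

[/]-ƛ-≡ : ∀ x T N → (ƛ x ⇒ T) [ N / x ] ≡ ƛ x ⇒ T
[/]-ƛ-≡ x T N rewrite dec-true (x ≟ x) refl = refl

[/]-ƛ-≢ : ∀ {x y} T N → ¬ y ≡ x → (ƛ y ⇒ T) [ N / x ] ≡ ƛ y ⇒ (T [ N / x ])
[/]-ƛ-≢ {x} {y} T N y≢x rewrite dec-false (y ≟ x) y≢x = refl

∈FV-ƛ⁻ : ∀ {v} x T → v ∈ FV (ƛ x ⇒ T) → v ∈ FV T
∈FV-ƛ⁻ x T = proj₁ ∘ ∈-filter⁻ (λ y → ¬? (y ≟ x)) {xs = FV T}

∈FV-ƛ⁺ : ∀ {v} x T → v ∈ FV T → ¬ v ≡ x → v ∈ FV (ƛ x ⇒ T)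
∈FV-ƛ⁺ x T = ∈-filter⁺ (λ y → ¬? (y ≟ x)) {xs = FV T}

∈FV-lams⁻ : ∀ {v} xs T → v ∈ FV (lams xs T) → v ∈ FV T
∈FV-lams⁻ [] T p = p
∈FV-lams⁻ (x ∷ xs) T p = ∈FV-lams⁻ xs T (∈FV-ƛ⁻ x (lams xs T) p)

[/]-fresh : ∀ {x U} T → x ∉ FV T → T [ U / x ] ≡ T
[/]-fresh (con c) _ = refl
[/]-fresh {x} (` y) x∉T with y ≟ x
... | yes refl = ⊥-elim (x∉T (here refl))
... | no y≢x = [/]-var-≢ _ y≢x
[/]-fresh {x} {U} (ƛ y ⇒ T) x∉T with y ≟ x
... | yes refl = [/]-ƛ-≡ y T U
... | no y≢x = trans ([/]-ƛ-≢ T U y≢x)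
                     (cong (ƛ_⇒_ y) ([/]-fresh T λ p → x∉T (∈FV-ƛ⁺ y T p (y≢x ∘ sym))))
[/]-fresh (T · T') x∉T =
  cong₂ _·_ ([/]-fresh T (x∉T ∘ ∈-++⁺ˡ)) ([/]-fresh T' (x∉T ∘ ∈-++⁺ʳ (FV T)))

[/]-id : ∀ {x} T → T [ ` x / x ] ≡ T
[/]-id (con c) = refl
[/]-id {x} (` y) with y ≟ x
... | yes refl = [/]-var-≡ y (` y)
... | no y≢x = [/]-var-≢ _ y≢x
[/]-id {x} (ƛ y ⇒ T) with y ≟ x
... | yes refl = [/]-ƛ-≡ y T (` y)
... | no y≢x = trans ([/]-ƛ-≢ T (` x) y≢x) (cong (ƛ_⇒_ y) ([/]-id T))
[/]-id (T · T') = cong₂ _·_ ([/]-id T) ([/]-id T')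

freeFor-fresh : ∀ {U x} T → x ∉ FV T → FreeFor U x T
freeFor-fresh (con c) _ = ff-con
freeFor-fresh (` y) _ = ff-var
freeFor-fresh (ƛ y ⇒ T) x∉T = ff-lam-nofree x∉T
freeFor-fresh (T · T') x∉T =
  ff-app (freeFor-fresh T (x∉T ∘ ∈-++⁺ˡ)) (freeFor-fresh T' (x∉T ∘ ∈-++⁺ʳ (FV T)))

freeFor-id : ∀ {x} T → FreeFor (` x) x T
freeFor-id (con c) = ff-con
freeFor-id (` y) = ff-var
freeFor-id {x} (ƛ y ⇒ T) with y ≟ x
... | yes refl = ff-lam-same
... | no y≢x = ff-lam y≢x (λ { (here y≡x) → y≢x y≡x }) (freeFor-id T)
freeFor-id (T · T') = ff-app (freeFor-id T) (freeFor-id T')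

β-fresh : ∀ x T N → x ∉ FV T → (ƛ x ⇒ T) · N ≡λ T
β-fresh x T N x∉T = λ-trans (λ-β (freeFor-fresh T x∉T)) (≡⇒≡λ ([/]-fresh T x∉T))

β-id : ∀ x T → (ƛ x ⇒ T) · ` x ≡λ T
β-id x T = λ-trans (λ-β (freeFor-id T)) (≡⇒≡λ ([/]-id T))

β-var : ∀ x N → (ƛ x ⇒ ` x) · N ≡λ N
β-var x N = λ-trans (λ-β ff-var) (≡⇒≡λ ([/]-var-≡ x N))

-- N need not be free for x in T or T', so each is first expanded to (ƛ x ⇒ ·) · ` x:
-- the β-step on the whole term then substitutes N only for these exposed occurrences of x.
β-·-distrib : ∀ x T T' N → (ƛ x ⇒ (T · T')) · N ≡λ ((ƛ x ⇒ T) · N) · ((ƛ x ⇒ T') · N)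
β-·-distrib x T T' N = begin
  (ƛ x ⇒ (T · T')) · N
    ≈⟨ λ-app (λ-lam (λ-app (β-id x T) (β-id x T'))) λ-refl ⟨
  (ƛ x ⇒ (((ƛ x ⇒ T) · ` x) · ((ƛ x ⇒ T') · ` x))) · N
    ≈⟨ λ-β (ff-app (ff-app ff-lam-same ff-var) (ff-app ff-lam-same ff-var)) ⟩
  (((ƛ x ⇒ T) · ` x) · ((ƛ x ⇒ T') · ` x)) [ N / x ]
    ≡⟨ cong₂ _·_ (cong₂ _·_ ([/]-ƛ-≡ x T N) ([/]-var-≡ x N))
                 (cong₂ _·_ ([/]-ƛ-≡ x T' N) ([/]-var-≡ x N)) ⟩
  ((ƛ x ⇒ T) · N) · ((ƛ x ⇒ T') · N) ∎

β-ƛ-comm : ∀ x y T N → ¬ y ≡ x → y ∉ FV N →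
           (ƛ x ⇒ (ƛ y ⇒ T)) · N ≡λ ƛ y ⇒ ((ƛ x ⇒ T) · N)
β-ƛ-comm x y T N y≢x y∉N = begin
  (ƛ x ⇒ (ƛ y ⇒ T)) · N
    ≈⟨ λ-app (λ-lam (λ-lam (β-id x T))) λ-refl ⟨
  (ƛ x ⇒ (ƛ y ⇒ ((ƛ x ⇒ T) · ` x))) · N
    ≈⟨ λ-β (ff-lam y≢x y∉N (ff-app ff-lam-same ff-var)) ⟩
  (ƛ y ⇒ ((ƛ x ⇒ T) · ` x)) [ N / x ]
    ≡⟨ trans ([/]-ƛ-≢ _ N y≢x) (cong (ƛ_⇒_ y) (cong₂ _·_ ([/]-ƛ-≡ x T N) ([/]-var-≡ x N))) ⟩
  ƛ y ⇒ ((ƛ x ⇒ T) · N) ∎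

β-lams-comm : ∀ x ys T N → x ∉ ys → (∀ {v} → v ∈ ys → v ∉ FV N) →
              (ƛ x ⇒ lams ys T) · N ≡λ lams ys ((ƛ x ⇒ T) · N)
β-lams-comm x [] T N _ _ = λ-refl
β-lams-comm x (y ∷ ys) T N x∉ys ys#N =
  λ-trans (β-ƛ-comm x y (lams ys T) N (x∉ys ∘ here ∘ sym) (ys#N (here refl)))
          (λ-lam (β-lams-comm x ys T N (x∉ys ∘ there) (ys#N ∘ there)))

lams-cong : ∀ xs {T T'} → T ≡λ T' → lams xs T ≡λ lams xs T'
lams-cong [] T≡T' = T≡T'
lams-cong (x ∷ xs) T≡T' = λ-lam (lams-cong xs T≡T')

apps-cong : ∀ Ns {T T'} → T ≡λ T' → apps T Ns ≡λ apps T' Ns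
apps-cong [] T≡T' = T≡T'
apps-cong (N ∷ Ns) T≡T' = apps-cong Ns (λ-app T≡T' λ-refl)

Env : Set
Env = List (Var × Tm)

vars : Env → List Var
vars = map proj₁

args : Env → List Tm
args = map proj₂

FVargs : Env → List Var
FVargs [] = []
FVargs ((x , N) ∷ ρ) = FV N ++ FVargs ρ

redexₑ : Env → Tm → Tm
redexₑ ρ T = apps (lams (vars ρ) T) (args ρ)

redexₑ-cong : ∀ ρ {T T'} → T ≡λ T' → redexₑ ρ T ≡λ redexₑ ρ T'
redexₑ-cong ρ = apps-cong (args ρ) ∘ lams-cong (vars ρ)

data NonCapturing : Env → Set where
  [] : NonCapturing []
  extend : ∀ {x N ρ} → x ∉ vars ρ → (∀ {v} → v ∈ vars ρ → v ∉ FV N) → NonCapturing ρ →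
           NonCapturing ((x , N) ∷ ρ)

redexₑ-∷ : ∀ {x N ρ} → NonCapturing ((x , N) ∷ ρ) → ∀ T →
           redexₑ ((x , N) ∷ ρ) T ≡λ redexₑ ρ ((ƛ x ⇒ T) · N)
redexₑ-∷ {x} {N} {ρ} (extend x∉ρ ρ#N _) T =
  apps-cong (args ρ) (β-lams-comm x (vars ρ) T N x∉ρ ρ#N)

module NC where

  redexₑ-fresh : ∀ ρ T → NonCapturing ρ → (∀ {v} → v ∈ vars ρ → v ∉ FV T) → redexₑ ρ T ≡λ T
  redexₑ-fresh [] T [] _ = λ-refl
  redexₑ-fresh ((x , N) ∷ ρ) T nc@(extend _ _ ncρ) ρ#T = begin
    redexₑ ((x , N) ∷ ρ) T    ≈⟨ redexₑ-∷ nc T ⟩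
    redexₑ ρ ((ƛ x ⇒ T) · N)  ≈⟨ redexₑ-cong ρ (β-fresh x T N (ρ#T (here refl))) ⟩
    redexₑ ρ T                ≈⟨ redexₑ-fresh ρ T ncρ (ρ#T ∘ there) ⟩
    T                         ∎

  redexₑ-· : ∀ ρ T T' → NonCapturing ρ → redexₑ ρ (T · T') ≡λ redexₑ ρ T · redexₑ ρ T'
  redexₑ-· [] T T' [] = λ-refl
  redexₑ-· ((x , N) ∷ ρ) T T' nc@(extend _ _ ncρ) = begin
    redexₑ ((x , N) ∷ ρ) (T · T')                               ≈⟨ redexₑ-∷ nc (T · T') ⟩
    redexₑ ρ ((ƛ x ⇒ (T · T')) · N)                             ≈⟨ redexₑ-cong ρ (β-·-distrib x T T' N) ⟩
    redexₑ ρ (((ƛ x ⇒ T) · N) · ((ƛ x ⇒ T') · N))               ≈⟨ redexₑ-· ρ _ _ ncρ ⟩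
    redexₑ ρ ((ƛ x ⇒ T) · N) · redexₑ ρ ((ƛ x ⇒ T') · N)        ≈⟨ λ-app (redexₑ-∷ nc T) (redexₑ-∷ nc T') ⟨
    redexₑ ((x , N) ∷ ρ) T · redexₑ ((x , N) ∷ ρ) T'            ∎

  redexₑ-ƛ : ∀ ρ y T → NonCapturing ρ → y ∉ vars ρ → y ∉ FVargs ρ →
             redexₑ ρ (ƛ y ⇒ T) ≡λ ƛ y ⇒ redexₑ ρ T
  redexₑ-ƛ [] y T [] _ _ = λ-refl
  redexₑ-ƛ ((x , N) ∷ ρ) y T nc@(extend _ _ ncρ) y∉vars y∉FVargs = begin
    redexₑ ((x , N) ∷ ρ) (ƛ y ⇒ T)      ≈⟨ redexₑ-∷ nc (ƛ y ⇒ T) ⟩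
    redexₑ ρ ((ƛ x ⇒ (ƛ y ⇒ T)) · N)    ≈⟨ redexₑ-cong ρ (β-ƛ-comm x y T N (y∉vars ∘ here) (y∉FVargs ∘ ∈-++⁺ˡ)) ⟩
    redexₑ ρ (ƛ y ⇒ ((ƛ x ⇒ T) · N))    ≈⟨ redexₑ-ƛ ρ y _ ncρ (y∉vars ∘ there) (y∉FVargs ∘ ∈-++⁺ʳ (FV N)) ⟩
    ƛ y ⇒ redexₑ ρ ((ƛ x ⇒ T) · N)      ≈⟨ λ-lam (redexₑ-∷ nc T) ⟨
    ƛ y ⇒ redexₑ ((x , N) ∷ ρ) T        ∎

  redexₑ-var : ∀ ρ {x N} → NonCapturing ρ → (x , N) ∈ ρ → redexₑ ρ (` x) ≡λ N
  redexₑ-var ((x , N) ∷ ρ) nc@(extend _ ρ#N ncρ) (here refl) = begin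
    redexₑ ((x , N) ∷ ρ) (` x)      ≈⟨ redexₑ-∷ nc (` x) ⟩
    redexₑ ρ ((ƛ x ⇒ ` x) · N)      ≈⟨ redexₑ-cong ρ (β-var x N) ⟩
    redexₑ ρ N                      ≈⟨ redexₑ-fresh ρ N ncρ ρ#N ⟩
    N                               ∎
  redexₑ-var ((y , M) ∷ ρ) {x} {N} nc@(extend y∉ρ _ ncρ) (there x↦N) = begin
    redexₑ ((y , M) ∷ ρ) (` x)      ≈⟨ redexₑ-∷ nc (` x) ⟩
    redexₑ ρ ((ƛ y ⇒ ` x) · M)      ≈⟨ redexₑ-cong ρ (β-fresh y (` x) M λ { (here refl) → y∉ρ (∈-map⁺ proj₁ x↦N) }) ⟩
    redexₑ ρ (` x)                  ≈⟨ redexₑ-var ρ ncρ x↦N ⟩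
    N                               ∎

Below : ℕ → List Var → Set
Below k vs = ∀ {v} → v ∈ vs → v < k

freshArgs : ℕ → Env → Env
freshArgs k [] = []
freshArgs k ((x , N) ∷ ρ) = (x , ` k) ∷ freshArgs (suc k) ρ

freshVars : ℕ → Env → Env
freshVars k [] = []
freshVars k ((x , N) ∷ ρ) = (k , N) ∷ freshVars (suc k) ρ

vars-freshArgs : ∀ k ρ → vars (freshArgs k ρ) ≡ vars ρ
vars-freshArgs k [] = refl
vars-freshArgs k ((x , N) ∷ ρ) = cong (x ∷_) (vars-freshArgs (suc k) ρ)

args-freshVars : ∀ k ρ → args (freshVars k ρ) ≡ args ρ
args-freshVars k [] = refl
args-freshVars k ((x , N) ∷ ρ) = cong (N ∷_) (args-freshVars (suc k) ρ)

FVargs-freshVars : ∀ k ρ → FVargs (freshVars k ρ) ≡ FVargs ρ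
FVargs-freshVars k [] = refl
FVargs-freshVars k ((x , N) ∷ ρ) = cong (FV N ++_) (FVargs-freshVars (suc k) ρ)

vars-freshVars-≥ : ∀ {v} k ρ → v ∈ vars (freshVars k ρ) → k ≤ v
vars-freshVars-≥ k ((x , N) ∷ ρ) (here refl) = ≤-refl
vars-freshVars-≥ k ((x , N) ∷ ρ) (there p) = <⇒≤ (vars-freshVars-≥ (suc k) ρ p)

FVargs-freshArgs-≥ : ∀ {v} k ρ → v ∈ FVargs (freshArgs k ρ) → k ≤ v
FVargs-freshArgs-≥ k ((x , N) ∷ ρ) (here refl) = ≤-refl
FVargs-freshArgs-≥ k ((x , N) ∷ ρ) (there p) = <⇒≤ (FVargs-freshArgs-≥ (suc k) ρ p)

∈-freshArgs-freshVars : ∀ k ρ {x N} → (x , N) ∈ ρ →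
                        Σ[ j ∈ ℕ ] (x , ` j) ∈ freshArgs k ρ × (j , N) ∈ freshVars k ρ
∈-freshArgs-freshVars k ((x , N) ∷ ρ) (here refl) = k , here refl , here refl
∈-freshArgs-freshVars k (_ ∷ ρ) (there x↦N) =
  let (j , x↦j , j↦N) = ∈-freshArgs-freshVars (suc k) ρ x↦N in j , there x↦j , there j↦N

freshArgs-nonCapturing : ∀ k ρ → Unique (vars ρ) → Below k (vars ρ) → NonCapturing (freshArgs k ρ)
freshArgs-nonCapturing k [] _ _ = []
freshArgs-nonCapturing k ((x , N) ∷ ρ) (x∉ρ ∷ u) ρ<k = extend
  (All¬⇒¬Any x∉ρ ∘ subst (x ∈_) (vars-freshArgs (suc k) ρ))
  (λ { p (here refl) → <-irrefl refl (ρ<k (there (subst (_ ∈_) (vars-freshArgs (suc k) ρ) p))) })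
  (freshArgs-nonCapturing (suc k) ρ u (m<n⇒m<1+n ∘ ρ<k ∘ there))

freshVars-nonCapturing : ∀ k ρ → Below k (FVargs ρ) → NonCapturing (freshVars k ρ)
freshVars-nonCapturing k [] _ = []
freshVars-nonCapturing k ((x , N) ∷ ρ) ρ<k = extend
  (<-irrefl refl ∘ vars-freshVars-≥ (suc k) ρ)
  (λ p q → <⇒≱ (ρ<k (∈-++⁺ˡ q)) (<⇒≤ (vars-freshVars-≥ (suc k) ρ p)))
  (freshVars-nonCapturing (suc k) ρ (m<n⇒m<1+n ∘ ρ<k ∘ ∈-++⁺ʳ (FV N)))

η-freshVars : ∀ k ρ G → Below k (FV G) →
              lams (vars (freshVars k ρ)) (apps G (args (freshArgs k ρ))) ≡λ G
η-freshVars k [] G _ = λ-refl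
η-freshVars k ((x , N) ∷ ρ) G G<k =
  λ-trans (λ-lam (η-freshVars (suc k) ρ (G · ` k) Gk<1+k)) (λ-η (<-irrefl refl ∘ G<k))
  where
  Gk<1+k : Below (suc k) (FV (G · ` k))
  Gk<1+k p with ∈-++⁻ (FV G) p
  ... | inj₁ q = m<n⇒m<1+n (G<k q)
  ... | inj₂ (here refl) = n<1+n k

redexₑ-split : ∀ k ρ T → Below k (FV T) →
               redexₑ ρ T ≡λ redexₑ (freshVars k ρ) (redexₑ (freshArgs k ρ) T)
redexₑ-split k ρ T T<k rewrite vars-freshArgs k ρ | args-freshVars k ρ =
  apps-cong (args ρ) (λ-sym (η-freshVars k ρ (lams (vars ρ) T) (T<k ∘ ∈FV-lams⁻ (vars ρ) T)))

above : List ℕ → ℕ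
above vs = suc (max 0 vs)

<above : ∀ vs → Below (above vs) vs
<above vs p = s≤s (lookup (xs≤max 0 vs) p)

module FreshBound (ρ : Env) (u : Unique (vars ρ)) (vs : List Var) where

  k : ℕ
  k = above (vs ++ vars ρ ++ FVargs ρ)

  vs<k : Below k vs
  vs<k = <above _ ∘ ∈-++⁺ˡ

  ρₐ ρᵥ : Env
  ρₐ = freshArgs k ρ
  ρᵥ = freshVars k ρ

  ncₐ : NonCapturing ρₐ
  ncₐ = freshArgs-nonCapturing k ρ u (<above _ ∘ ∈-++⁺ʳ vs ∘ ∈-++⁺ˡ)

  ncᵥ : NonCapturing ρᵥ
  ncᵥ = freshVars-nonCapturing k ρ (<above _ ∘ ∈-++⁺ʳ vs ∘ ∈-++⁺ʳ (vars ρ))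

  vs#varsᵥ : ∀ {v} → v ∈ vs → v ∉ vars ρᵥ
  vs#varsᵥ p q = <⇒≱ (vs<k p) (vars-freshVars-≥ k ρ q)

  vs#FVargsₐ : ∀ {v} → v ∈ vs → v ∉ FVargs ρₐ
  vs#FVargsₐ p q = <⇒≱ (vs<k p) (FVargs-freshArgs-≥ k ρ q)

redexₑ-fresh : ∀ ρ T → Unique (vars ρ) → (∀ {v} → v ∈ vars ρ → v ∉ FV T) → redexₑ ρ T ≡λ T
redexₑ-fresh ρ T u ρ#T = begin
  redexₑ ρ T                ≈⟨ redexₑ-split k ρ T vs<k ⟩
  redexₑ ρᵥ (redexₑ ρₐ T)   ≈⟨ redexₑ-cong ρᵥ (NC.redexₑ-fresh ρₐ T ncₐ (ρ#T ∘ subst (_ ∈_) (vars-freshArgs k ρ))) ⟩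
  redexₑ ρᵥ T               ≈⟨ NC.redexₑ-fresh ρᵥ T ncᵥ (λ p q → vs#varsᵥ q p) ⟩
  T                         ∎
  where open FreshBound ρ u (FV T)

redexₑ-· : ∀ ρ T T' → Unique (vars ρ) → redexₑ ρ (T · T') ≡λ redexₑ ρ T · redexₑ ρ T'
redexₑ-· ρ T T' u = begin
  redexₑ ρ (T · T')                                   ≈⟨ redexₑ-split k ρ (T · T') vs<k ⟩
  redexₑ ρᵥ (redexₑ ρₐ (T · T'))                      ≈⟨ redexₑ-cong ρᵥ (NC.redexₑ-· ρₐ T T' ncₐ) ⟩
  redexₑ ρᵥ (redexₑ ρₐ T · redexₑ ρₐ T')              ≈⟨ NC.redexₑ-· ρᵥ _ _ ncᵥ ⟩
  redexₑ ρᵥ (redexₑ ρₐ T) · redexₑ ρᵥ (redexₑ ρₐ T')  ≈⟨ λ-app (redexₑ-split k ρ T (vs<k ∘ ∈-++⁺ˡ))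
                                                               (redexₑ-split k ρ T' (vs<k ∘ ∈-++⁺ʳ (FV T))) ⟨
  redexₑ ρ T · redexₑ ρ T'                            ∎
  where open FreshBound ρ u (FV (T · T'))

redexₑ-ƛ : ∀ ρ y T → Unique (vars ρ) → y ∉ vars ρ → y ∉ FVargs ρ →
           redexₑ ρ (ƛ y ⇒ T) ≡λ ƛ y ⇒ redexₑ ρ T
redexₑ-ƛ ρ y T u y∉vars y∉FVargs = begin
  redexₑ ρ (ƛ y ⇒ T)              ≈⟨ redexₑ-split k ρ (ƛ y ⇒ T) (vs<k ∘ there ∘ ∈FV-ƛ⁻ y T) ⟩
  redexₑ ρᵥ (redexₑ ρₐ (ƛ y ⇒ T)) ≈⟨ redexₑ-cong ρᵥ (NC.redexₑ-ƛ ρₐ y T ncₐ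
                                       (y∉vars ∘ subst (y ∈_) (vars-freshArgs k ρ)) (vs#FVargsₐ (here refl))) ⟩
  redexₑ ρᵥ (ƛ y ⇒ redexₑ ρₐ T)   ≈⟨ NC.redexₑ-ƛ ρᵥ y _ ncᵥ
                                       (vs#varsᵥ (here refl)) (y∉FVargs ∘ subst (y ∈_) (FVargs-freshVars k ρ)) ⟩
  ƛ y ⇒ redexₑ ρᵥ (redexₑ ρₐ T)   ≈⟨ λ-lam (redexₑ-split k ρ T (vs<k ∘ there)) ⟨
  ƛ y ⇒ redexₑ ρ T                ∎
  where open FreshBound ρ u (y ∷ FV T)

redexₑ-var : ∀ ρ {x N} → Unique (vars ρ) → (x , N) ∈ ρ → redexₑ ρ (` x) ≡λ N
redexₑ-var ρ {x} {N} u x↦N =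
  let (j , x↦j , j↦N) = ∈-freshArgs-freshVars k ρ x↦N in begin
  redexₑ ρ (` x)               ≈⟨ redexₑ-split k ρ (` x) vs<k ⟩
  redexₑ ρᵥ (redexₑ ρₐ (` x))  ≈⟨ redexₑ-cong ρᵥ (NC.redexₑ-var ρₐ ncₐ x↦j) ⟩
  redexₑ ρᵥ (` j)              ≈⟨ NC.redexₑ-var ρᵥ ncᵥ j↦N ⟩
  N                            ∎
  where open FreshBound ρ u (x ∷ [])

env : Subst → Env
env = map λ (x , M , _) → x , ⌜ M ⌝

vars-env : ∀ θ → vars (env θ) ≡ dom θ
vars-env θ = sym (map-∘ θ)

FVargs-env : ∀ θ → FVargs (env θ) ≡ FVrange θ
FVargs-env [] = refl
FVargs-env ((_ , M , _) ∷ θ) = cong (FVc M ++_) (FVargs-env θ)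

redex≡redexₑ : ∀ θ t → redex θ t ≡ redexₑ (env θ) ⌜ t ⌝
redex≡redexₑ θ t = cong₂ (λ xs Ns → apps (lams xs ⌜ t ⌝) Ns) (map-∘ θ) (map-∘ θ)

mutual
  hs-sound : ∀ {θ t t'} → DistinctVars θ → HS θ t t' → redexₑ (env θ) ⌜ t ⌝ ≡λ ⌜ t' ⌝
  hs-sound u (hs-atm-a R↝R') = hsra-sound u R↝R'
  hs-sound u (hs-atm-c R↝M) = hsrc-sound u R↝M
  hs-sound {θ} u (hs-lam {x} {M} x∉dom x∉FVrange M↝M') =
    λ-trans (redexₑ-ƛ (env θ) x ⌜ M ⌝ (subst Unique (sym (vars-env θ)) u)
                      (x∉dom ∘ subst (x ∈_) (vars-env θ)) (x∉FVrange ∘ subst (x ∈_) (FVargs-env θ)))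
            (λ-lam (hs-sound u M↝M'))

  hsra-sound : ∀ {θ R R'} → DistinctVars θ → HSra θ R R' → redexₑ (env θ) ⌜ R ⌝ᵣ ≡λ ⌜ R' ⌝ᵣ
  hsra-sound {θ} u (hsa-cst {c}) =
    redexₑ-fresh (env θ) (con c) (subst Unique (sym (vars-env θ)) u) λ _ ()
  hsra-sound {θ} u (hsa-var {x} x∉dom) =
    redexₑ-fresh (env θ) (` x) (subst Unique (sym (vars-env θ)) u)
                 λ { p (here refl) → x∉dom (subst (_ ∈_) (vars-env θ) p) }
  hsra-sound {θ} u (hsa-app {R} {_} {M} R↝R' M↝M') =
    λ-trans (redexₑ-· (env θ) ⌜ R ⌝ᵣ ⌜ M ⌝ (subst Unique (sym (vars-env θ)) u))
            (λ-app (hsra-sound u R↝R') (hs-sound u M↝M'))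

  hsrc-sound : ∀ {θ R M α} → DistinctVars θ → HSrc θ R M α → redexₑ (env θ) ⌜ R ⌝ᵣ ≡λ ⌜ M ⌝
  hsrc-sound {θ} u (hsc-var x↦M) =
    redexₑ-var (env θ) (subst Unique (sym (vars-env θ)) u) (∈-map⁺ _ x↦M)
  hsrc-sound {θ} u (hsc-app {R} {M} R↝λM' M↝M'' M'↝M''') =
    λ-trans (redexₑ-· (env θ) ⌜ R ⌝ᵣ ⌜ M ⌝ (subst Unique (sym (vars-env θ)) u))
    (λ-trans (λ-app (hsrc-sound u R↝λM') (hs-sound u M↝M''))
             (hs-sound ([] ∷ []) M'↝M'''))

-- The arity typing only guarantees that t' exists; the conversion holds for every derivation.
theorem5p1 : (Θ : ACtx) → WellFormedCtx Θ →
    (θ : Subst) → DistinctVars θ → ArityPreserving θ Θ →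
    (t : Can) (α : Arity) → ctx θ ⊕ Θ ⊢ t ⇐ α →
    (t' : Can) → HS θ t t' →
    redex θ t ≡λ ⌜ t' ⌝
theorem5p1 _ _ θ distinct _ t _ _ t' t↝t' =
  subst (_≡λ ⌜ t' ⌝) (sym (redex≡redexₑ θ t)) (hs-sound distinct t↝t')
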